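{- For rooted trees on $n$ nodes of bounded depth (depth at most a constant $d$), there is a routing labeling scheme (in the designer-port model) with labels of length $\log n + \mathcal{O}(\log\log n)$ bits.
   Context: Trees are rooted; $\mathsf{deg}(u)$ denotes the number of children of node $u$; the depth of a tree is the maximum number of edges on a root-to-leaf path. A routing labeling scheme (designer-port model) for a family $\mathcal{T}$ of rooted trees consists of an encoder and a decoder. The encoder takes $T\in\mathcal{T}$, assigns a binary string (label) $\ell(u)$ to every node $u$, and labels every edge from a node $u$ to one of its children with a distinct port number from $\{1,\ldots,\mathsf{deg}(u)\}$ (chosen by the encoder). The decoder receives only $\ell(u)$ and $\ell(w)$ for two distinct nodes $u,w$ of some $T\in\mathcal{T}$ (and no other information about $T$, except that $\lceil\log n\rceil$ may be assumed known); it must return $0$ if the next node on the path from $u$ to $w$ is the parent of $u$, and otherwise the port number of the first edge on the path from $u$ to $w$. The length is the maximum label length. Logarithms are base 2; the constant in $\mathcal{O}$ may depend on $d$. -}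

module Defs where

open import Data.Nat using (ℕ; zero; suc; _+_; _⊔_)
open import Data.Fin using (Fin; toℕ; _≟_)
open import Data.List using (List; []; _∷_; length; lookup)
open import Data.Maybe using (Maybe; just; nothing)
open import Relation.Nullary using (yes; no)
open import Relation.Binary.PropositionalEquality using (refl)

-- Finite rooted ordered trees (the order of children is only a
-- bookkeeping device; port numbers are chosen separately by the encoder).
data Tree : Set where
  node : List Tree → Tree

children : Tree → List Tree
children (node ts) = ts

deg : Tree → ℕ
deg t = length (children t)

mutual
  size : Tree → ℕ
  size (node ts) = suc (sizes ts)

  sizes : List Tree → ℕ
  sizes [] = 0
  sizes (t ∷ ts) = size t + sizes ts

mutual
  depth : Tree → ℕ
  depth (node ts) = depths ts

  depths : List Tree → ℕ
  depths [] = 0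
  depths (t ∷ ts) = suc (depth t) ⊔ depths ts

data Node : Tree → Set where
  root : ∀ {t} → Node t
  down : ∀ {ts} (i : Fin (length ts)) → Node (lookup ts i) → Node (node ts)

subtree : (t : Tree) → Node t → Tree
subtree t root = t
subtree (node ts) (down i u) = subtree (lookup ts i) u

-- First step of the path from u to w:
-- nothing = go to the parent of u; just i = go to the i-th child of u.
nextHop : (t : Tree) → (u w : Node t) → Maybe (Fin (deg (subtree t u)))
nextHop t root root = nothing
nextHop (node ts) root (down i w) = just i
nextHop (node ts) (down i u) root = nothing
nextHop (node ts) (down i u) (down j w) with i ≟ j
... | yes refl = nextHop (lookup ts i) u w
... | no _ = nothing

-- Port assignment: at every node u, children are numbered by distinct
-- ports from {1,…,deg u}; children index c gets port  1 + toℕ (σ u c).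
PortAssignment : Tree → Set
PortAssignment t = (u : Node t) → Fin (deg (subtree t u)) → Fin (deg (subtree t u))

routeAnswer : (t : Tree) → PortAssignment t → Node t → Node t → ℕ
routeAnswer t σ u w with nextHop t u w
... | nothing = 0
... | just c = suc (toℕ (σ u c))

module Submission where

-- Number the children of every node heaviest first (by subtree size), so
-- that the child behind port p holds less than a 1/p fraction of its
-- parent's subtree.  The label of u lists the ports p₁ … pₖ on the path from
-- the root to u (k ≤ d); hence p₁ ⋯ pₖ ≤ n and Σ ⌊log₂ pᵢ⌋ ≤ ⌈log₂ n⌉.  Each
-- port p is written as a self-delimiting code word: ⌊log₂ p⌋ in a header of
-- 1 + ⌈log₂ ⌈log₂ n⌉⌉ bits, then p itself in 1 + ⌊log₂ p⌋ bits, so a label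
-- has at most ⌈log₂ n⌉ + d (2 + ⌈log₂ ⌈log₂ n⌉⌉) bits.  The decoder parses
-- both root paths: if the path of u is a proper prefix of the path of w it
-- answers the next port on the path of w, otherwise 0 (go to the parent).

open import Defs
open import Data.Bool using (Bool; true; false; if_then_else_)
open import Data.Fin as Fin using (Fin; toℕ; fromℕ<)
open import Data.Fin.Properties using (toℕ-injective; toℕ-fromℕ<; toℕ<n)
open import Data.List using (List; []; _∷_; _++_; length; lookup; map)
open import Data.List.Properties using (++-assoc; length-++)
open import Data.List.Relation.Unary.All as All using (All; []; _∷_)
open import Data.Maybe using (just; nothing)
open import Data.Nat
open import Data.Nat.Properties
open import Data.Nat.ListAction using (sum; product)
open import Data.Nat.Logarithm using (⌊log₂_⌋; ⌈log₂_⌉)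
open import Data.Nat.Logarithm.Core using (⌊log2⌋; ⌈log2⌉)
open import Data.Nat.Solver using (module +-*-Solver)
open import Data.Product using (Σ; _×_; ∃-syntax; _,_; proj₁; proj₂; map₁; uncurry)
open import Function using (_∘_)
open import Function.Definitions using (Injective)
open import Induction.WellFounded using (Acc; acc)
open import Relation.Binary.Definitions using (tri<; tri≈; tri>)
open import Relation.Binary.PropositionalEquality
open import Relation.Nullary using (¬_; Dec; yes; no; does; contradiction)
open import Relation.Nullary.Decidable using (dec-true; dec-false)
open import Relation.Unary using (Pred; Decidable; _⊆_)
open import Relation.Unary.Properties using (U?)
open import Algebra.Properties.Monoid.Sum +-0-monoid using () renaming (sum to ∑)

-- Binary numerals, least significant bit first

bitValue : Bool → ℕ
bitValue false = 0
bitValue true  = 1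

bitValue≤1 : ∀ b → bitValue b ≤ 1
bitValue≤1 false = z≤n
bitValue≤1 true  = ≤-refl

lowBit : ℕ → Bool
lowBit zero          = false
lowBit (suc zero)    = true
lowBit (suc (suc n)) = lowBit n

halve-spec : ∀ n → bitValue (lowBit n) + 2 * ⌊ n /2⌋ ≡ n
halve-spec zero          = refl
halve-spec (suc zero)    = refl
halve-spec (suc (suc n)) = begin
  b + 2 * suc ⌊ n /2⌋          ≡⟨ cong (b +_) (*-suc 2 ⌊ n /2⌋) ⟩
  b + suc (suc (2 * ⌊ n /2⌋))  ≡⟨ +-suc b _ ⟩
  suc (b + suc (2 * ⌊ n /2⌋))  ≡⟨ cong suc (+-suc b _) ⟩
  suc (suc (b + 2 * ⌊ n /2⌋))  ≡⟨ cong (λ m → suc (suc m)) (halve-spec n) ⟩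
  suc (suc n)                  ∎
  where
    open ≡-Reasoning
    b : ℕ
    b = bitValue (lowBit n)

twice-half≤ : ∀ n → 2 * ⌊ n /2⌋ ≤ n
twice-half≤ n = subst (2 * ⌊ n /2⌋ ≤_) (halve-spec n) (m≤n+m _ (bitValue (lowBit n)))

≤1+twice-half : ∀ n → n ≤ suc (2 * ⌊ n /2⌋)
≤1+twice-half n = subst (_≤ suc (2 * ⌊ n /2⌋)) (halve-spec n)
  (+-monoˡ-≤ (2 * ⌊ n /2⌋) (bitValue≤1 (lowBit n)))

-- The w-bit representation of v (faithful when v < 2 ^ w).
bits : ℕ → ℕ → List Bool
bits zero    v = []
bits (suc w) v = lowBit v ∷ bits w ⌊ v /2⌋

length-bits : ∀ w v → length (bits w v) ≡ w
length-bits zero    v = refl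
length-bits (suc w) v = cong suc (length-bits w ⌊ v /2⌋)

readBits : ℕ → List Bool → ℕ × List Bool
readBits zero    bs       = 0 , bs
readBits (suc w) []       = 0 , []
readBits (suc w) (b ∷ bs) = map₁ (λ v → bitValue b + 2 * v) (readBits w bs)

readBits-bits : ∀ w v rest → v < 2 ^ w → readBits w (bits w v ++ rest) ≡ (v , rest)
readBits-bits zero    zero    rest _ = refl
readBits-bits zero    (suc v) rest (s≤s ())
readBits-bits (suc w) v       rest v<2^[1+w] = begin
  map₁ (λ x → b + 2 * x) (readBits w (bits w ⌊ v /2⌋ ++ rest))
    ≡⟨ cong (map₁ (λ x → b + 2 * x)) (readBits-bits w ⌊ v /2⌋ rest half<) ⟩
  (b + 2 * ⌊ v /2⌋ , rest)  ≡⟨ cong (_, rest) (halve-spec v) ⟩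
  (v , rest)                ∎
  where
    open ≡-Reasoning
    b : ℕ
    b = bitValue (lowBit v)
    half< : ⌊ v /2⌋ < 2 ^ w
    half< = *-cancelˡ-< 2 _ _ (≤-<-trans (twice-half≤ v) v<2^[1+w])

-- Base-two logarithms.  The library defines ⌊log₂_⌋ and ⌈log₂_⌉ by
-- well-founded recursion on halving; they bracket n between powers of two.

⌊log2⌋-bounds : ∀ n (a : Acc _<_ (suc n)) →
  2 ^ ⌊log2⌋ (suc n) a ≤ suc n × suc n < 2 ^ suc (⌊log2⌋ (suc n) a)
⌊log2⌋-bounds zero    _        = ≤-refl , s≤s (s≤s z≤n)
⌊log2⌋-bounds (suc n) (acc rs) = lower , upper
  where
    open ≤-Reasoning
    h : ℕ
    h = ⌊ n /2⌋
    x : ℕ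
    x = ⌊log2⌋ (suc h) (rs (⌊n/2⌋<n (suc n)))
    ih : 2 ^ x ≤ suc h × suc h < 2 ^ suc x
    ih = ⌊log2⌋-bounds h (rs (⌊n/2⌋<n (suc n)))
    lower : 2 * 2 ^ x ≤ suc (suc n)
    lower = begin
      2 * 2 ^ x    ≤⟨ *-monoʳ-≤ 2 (proj₁ ih) ⟩
      2 * suc h    ≤⟨ twice-half≤ (suc (suc n)) ⟩
      suc (suc n)  ∎
    upper : suc (suc n) < 2 * 2 ^ suc x
    upper = begin-strict
      suc (suc n)            ≤⟨ ≤1+twice-half (suc (suc n)) ⟩
      suc (2 * suc h)        <⟨ n<1+n _ ⟩
      suc (suc (2 * suc h))  ≡⟨ *-suc 2 (suc h) ⟨
      2 * suc (suc h)        ≤⟨ *-monoʳ-≤ 2 (proj₂ ih) ⟩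
      2 * 2 ^ suc x          ∎

2^⌊log₂n⌋≤n : ∀ n .{{_ : NonZero n}} → 2 ^ ⌊log₂ n ⌋ ≤ n
2^⌊log₂n⌋≤n (suc n) = proj₁ (⌊log2⌋-bounds n _)

n<2^[1+⌊log₂n⌋] : ∀ n → n < 2 ^ suc ⌊log₂ n ⌋
n<2^[1+⌊log₂n⌋] zero    = s≤s z≤n
n<2^[1+⌊log₂n⌋] (suc n) = proj₂ (⌊log2⌋-bounds n _)

n≤2^⌈log2⌉n : ∀ n (a : Acc _<_ n) → n ≤ 2 ^ ⌈log2⌉ n a
n≤2^⌈log2⌉n zero            _        = z≤n
n≤2^⌈log2⌉n (suc zero)      _        = ≤-refl
n≤2^⌈log2⌉n n@(suc (suc m)) (acc rs) = begin
  n            ≤⟨ ≤-pred (≤1+twice-half (suc n)) ⟩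
  2 * ⌈ n /2⌉  ≤⟨ *-monoʳ-≤ 2 (n≤2^⌈log2⌉n (suc ⌈ m /2⌉) (rs (⌈n/2⌉<n m))) ⟩
  2 * 2 ^ ⌈log2⌉ (suc ⌈ m /2⌉) (rs (⌈n/2⌉<n m)) ∎
  where open ≤-Reasoning

n≤2^⌈log₂n⌉ : ∀ n → n ≤ 2 ^ ⌈log₂ n ⌉
n≤2^⌈log₂n⌉ n = n≤2^⌈log2⌉n n _

2^-cancel-≤ : ∀ {a b} → 2 ^ a ≤ 2 ^ b → a ≤ b
2^-cancel-≤ {a} {b} 2^a≤2^b with a ≤? b
... | yes a≤b = a≤b
... | no  a≰b = contradiction 2^a≤2^b (<⇒≱ (^-monoʳ-< 2 (s≤s (s≤s z≤n)) (≰⇒> a≰b)))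

-- Self-delimiting codes for lists of numbers.

codeWord : ℕ → ℕ → List Bool
codeWord W p = bits W ⌊log₂ p ⌋ ++ bits (suc ⌊log₂ p ⌋) p

readCodeWord : ℕ → List Bool → ℕ × List Bool
readCodeWord W bs = uncurry (λ h → readBits (suc h)) (readBits W bs)

readCodeWord-codeWord : ∀ W p rest → ⌊log₂ p ⌋ < 2 ^ W →
  readCodeWord W (codeWord W p ++ rest) ≡ (p , rest)
readCodeWord-codeWord W p rest header-fits = begin
  readCodeWord W ((bits W h ++ body) ++ rest)
    ≡⟨ cong (readCodeWord W) (++-assoc (bits W h) body rest) ⟩
  uncurry (λ h → readBits (suc h)) (readBits W (bits W h ++ body ++ rest))
    ≡⟨ cong (uncurry (λ h → readBits (suc h))) (readBits-bits W h (body ++ rest) header-fits) ⟩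
  readBits (suc h) (body ++ rest)
    ≡⟨ readBits-bits (suc h) p rest (n<2^[1+⌊log₂n⌋] p) ⟩
  (p , rest) ∎
  where
    open ≡-Reasoning
    h : ℕ
    h = ⌊log₂ p ⌋
    body : List Bool
    body = bits (suc h) p

encodeList : ℕ → List ℕ → List Bool
encodeList W []       = []
encodeList W (p ∷ ps) = codeWord W p ++ encodeList W ps

readCodeWords : ℕ → ℕ → List Bool → List ℕ
readCodeWords zero    W bs         = []
readCodeWords (suc f) W []         = []
readCodeWords (suc f) W bs@(_ ∷ _) =
  proj₁ (readCodeWord W bs) ∷ readCodeWords f W (proj₂ (readCodeWord W bs))

-- Code words are nonempty, so the input length bounds the number of words.
decodeList : ℕ → List Bool → List ℕ
decodeList W bs = readCodeWords (length bs) W bs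

-- Total cost of the code words of ps beyond their headers and leading bits.
logSum : List ℕ → ℕ
logSum ps = sum (map ⌊log₂_⌋ ps)

length-encodeList : ∀ W ps → length (encodeList W ps) ≡ length ps * suc W + logSum ps
length-encodeList W []       = refl
length-encodeList W (p ∷ ps) = begin
  length (codeWord W p ++ encodeList W ps)
    ≡⟨ length-++ (codeWord W p) ⟩
  length (codeWord W p) + length (encodeList W ps)
    ≡⟨ cong₂ _+_ length-codeWord (length-encodeList W ps) ⟩
  (W + suc h) + (length ps * suc W + logSum ps)
    ≡⟨ solve 4 (λ w h k s → (w :+ (con 1 :+ h)) :+ (k :* (con 1 :+ w) :+ s)
                          := (con 1 :+ w :+ k :* (con 1 :+ w)) :+ (h :+ s))
             refl W h (length ps) (logSum ps) ⟩
  (suc W + length ps * suc W) + (h + logSum ps) ∎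
  where
    open ≡-Reasoning
    open +-*-Solver
    h : ℕ
    h = ⌊log₂ p ⌋
    length-codeWord : length (codeWord W p) ≡ W + suc h
    length-codeWord = trans (length-++ (bits W h)) (cong₂ _+_ (length-bits W h) (length-bits (suc h) p))

-- A positive header width makes every code word start with a bit, which is
-- how the reader tells a further code word from the end of the input.
readCodeWords-encodeList : ∀ w f ps → All (λ p → ⌊log₂ p ⌋ < 2 ^ suc w) ps → length ps ≤ f →
  readCodeWords f (suc w) (encodeList (suc w) ps) ≡ ps
readCodeWords-encodeList w zero    []       _                  _         = refl
readCodeWords-encodeList w (suc f) []       _                  _         = refl
readCodeWords-encodeList w (suc f) (p ∷ ps) (fits ∷ fits-rest) (s≤s k≤f) =
  cong₂ _∷_ (cong proj₁ read-first)
            (trans (cong (readCodeWords f (suc w) ∘ proj₂) read-first)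
                   (readCodeWords-encodeList w f ps fits-rest k≤f))
  where
    read-first : readCodeWord (suc w) (codeWord (suc w) p ++ encodeList (suc w) ps)
                   ≡ (p , encodeList (suc w) ps)
    read-first = readCodeWord-codeWord (suc w) p (encodeList (suc w) ps) fits

decodeList-encodeList : ∀ w ps → All (λ p → ⌊log₂ p ⌋ < 2 ^ suc w) ps →
  decodeList (suc w) (encodeList (suc w) ps) ≡ ps
decodeList-encodeList w ps fits = readCodeWords-encodeList w _ ps fits enough-fuel
  where
    enough-fuel : length ps ≤ length (encodeList (suc w) ps)
    enough-fuel = subst (length ps ≤_) (sym (length-encodeList (suc w) ps))
      (≤-trans (m≤m*n (length ps) (suc (suc w))) (m≤m+n _ (logSum ps)))

log≤logSum : ∀ ps → All (λ p → ⌊log₂ p ⌋ ≤ logSum ps) ps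
log≤logSum []       = []
log≤logSum (p ∷ ps) = m≤m+n _ _ ∷ All.map (λ le → ≤-trans le (m≤n+m _ _)) (log≤logSum ps)

2^logSum≤product : ∀ ps → All NonZero ps → 2 ^ logSum ps ≤ product ps
2^logSum≤product []       []           = ≤-refl
2^logSum≤product (p ∷ ps) (p≢0 ∷ ps≢0) = begin
  2 ^ (⌊log₂ p ⌋ + logSum ps)    ≡⟨ ^-distribˡ-+-* 2 ⌊log₂ p ⌋ (logSum ps) ⟩
  2 ^ ⌊log₂ p ⌋ * 2 ^ logSum ps  ≤⟨ *-mono-≤ (2^⌊log₂n⌋≤n p {{p≢0}}) (2^logSum≤product ps ps≢0) ⟩
  p * product ps                 ∎
  where open ≤-Reasoning

-- Counting and heavy-first ranking

count : ∀ {k ℓ} {P : Pred (Fin k) ℓ} → Decidable P → ℕ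
count {zero}  P? = 0
count {suc k} P? with P? Fin.zero
... | yes _ = suc (count (λ j → P? (Fin.suc j)))
... | no  _ = count (λ j → P? (Fin.suc j))

count-mono : ∀ {k ℓ₁ ℓ₂} {P : Pred (Fin k) ℓ₁} {Q : Pred (Fin k) ℓ₂}
  (P? : Decidable P) (Q? : Decidable Q) → P ⊆ Q → count P? ≤ count Q?
count-mono {zero}  P? Q? P⊆Q = z≤n
count-mono {suc k} P? Q? P⊆Q with P? Fin.zero | Q? Fin.zero
... | yes _ | yes _ = s≤s (count-mono (λ j → P? (Fin.suc j)) (λ j → Q? (Fin.suc j)) P⊆Q)
... | yes p | no ¬q = contradiction (P⊆Q p) ¬q
... | no _  | yes _ = m≤n⇒m≤1+n (count-mono (λ j → P? (Fin.suc j)) (λ j → Q? (Fin.suc j)) P⊆Q)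
... | no _  | no _  = count-mono (λ j → P? (Fin.suc j)) (λ j → Q? (Fin.suc j)) P⊆Q

count-strict : ∀ {k ℓ₁ ℓ₂} {P : Pred (Fin k) ℓ₁} {Q : Pred (Fin k) ℓ₂}
  (P? : Decidable P) (Q? : Decidable Q) → P ⊆ Q → ∀ x → Q x → ¬ P x → count P? < count Q?
count-strict P? Q? P⊆Q Fin.zero qx ¬px with P? Fin.zero | Q? Fin.zero
... | yes px | _     = contradiction px ¬px
... | no _   | yes _ = s≤s (count-mono (λ j → P? (Fin.suc j)) (λ j → Q? (Fin.suc j)) P⊆Q)
... | no _   | no ¬q = contradiction qx ¬q
count-strict P? Q? P⊆Q (Fin.suc x) qx ¬px with P? Fin.zero | Q? Fin.zero
... | yes _ | yes _ = s≤s (count-strict (λ j → P? (Fin.suc j)) (λ j → Q? (Fin.suc j)) P⊆Q x qx ¬px)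
... | yes p | no ¬q = contradiction (P⊆Q p) ¬q
... | no _  | yes _ = m<n⇒m<1+n (count-strict (λ j → P? (Fin.suc j)) (λ j → Q? (Fin.suc j)) P⊆Q x qx ¬px)
... | no _  | no _  = count-strict (λ j → P? (Fin.suc j)) (λ j → Q? (Fin.suc j)) P⊆Q x qx ¬px

count-all : ∀ k → count {k} U? ≡ k
count-all zero    = refl
count-all (suc k) = cong suc (count-all k)

count-weighted : ∀ {k ℓ} {Q : Pred (Fin k) ℓ} (Q? : Decidable Q) (f : Fin k → ℕ) a →
  (∀ {j} → Q j → a ≤ f j) → count Q? * a ≤ ∑ f
count-weighted {zero}  Q? f a heavy = z≤n
count-weighted {suc k} Q? f a heavy with Q? Fin.zero
... | yes q = +-mono-≤ (heavy q) (count-weighted (λ j → Q? (Fin.suc j)) (λ j → f (Fin.suc j)) a heavy)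
... | no  _ = ≤-trans (count-weighted (λ j → Q? (Fin.suc j)) (λ j → f (Fin.suc j)) a heavy)
                      (m≤n+m _ (f Fin.zero))

leading-≤ : ∀ {k x y a b} → b < k → x * k + a ≤ y * k + b → x ≤ y
leading-≤ {k} {x} {y} {a} {b} b<k le with x ≤? y
... | yes x≤y = x≤y
... | no  x≰y = contradiction le (<⇒≱ (begin-strict
  y * k + b    <⟨ +-monoʳ-< (y * k) b<k ⟩
  y * k + k    ≡⟨ +-comm (y * k) k ⟩
  suc y * k    ≤⟨ *-monoˡ-≤ k (≰⇒> x≰y) ⟩
  x * k        ≤⟨ m≤m+n (x * k) a ⟩
  x * k + a    ∎))
  where open ≤-Reasoning

-- Heavy-first ranking of k weighted indices: rank i is the number of
-- indices strictly heavier than i, ties broken by position.  It is a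
-- permutation, and the index of rank r weighs at most 1/(r+1) of the total.
module HeavyFirst {k : ℕ} (s : Fin k → ℕ) where

  -- key j encodes the pair (s j , j) lexicographically
  key : Fin k → ℕ
  key j = s j * k + toℕ j

  key-≤ : ∀ {i j} → key i ≤ key j → s i ≤ s j
  key-≤ {i} {j} = leading-≤ (toℕ<n j)

  key-injective : ∀ {i j} → key i ≡ key j → i ≡ j
  key-injective {i} {j} eq = toℕ-injective (+-cancelˡ-≡ (s i * k) _ _ (begin
    s i * k + toℕ i  ≡⟨ eq ⟩
    s j * k + toℕ j  ≡⟨ cong (λ x → x * k + toℕ j) same-weight ⟨
    s i * k + toℕ j  ∎))
    where
      open ≡-Reasoning
      same-weight : s i ≡ s j
      same-weight = ≤-antisym (key-≤ (≤-reflexive eq)) (key-≤ (≤-reflexive (sym eq)))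

  heavier? : ∀ i → Decidable (λ j → key i < key j)
  heavier? i j = key i <? key j

  atLeastAsHeavy? : ∀ i → Decidable (λ j → key i ≤ key j)
  atLeastAsHeavy? i j = key i ≤? key j

  -- i itself is at least as heavy as i, but not heavier
  heavier<atLeastAsHeavy : ∀ i → count (heavier? i) < count (atLeastAsHeavy? i)
  heavier<atLeastAsHeavy i =
    count-strict (heavier? i) (atLeastAsHeavy? i) <⇒≤ i ≤-refl (<-irrefl refl)

  rank< : ∀ i → count (heavier? i) < k
  rank< i = subst (count (heavier? i) <_) (count-all k)
    (count-strict (heavier? i) U? _ i _ (<-irrefl refl))

  rank : Fin k → Fin k
  rank i = fromℕ< (rank< i)

  rank-counts : ∀ {i j} → rank i ≡ rank j → count (heavier? i) ≡ count (heavier? j)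
  rank-counts {i} {j} eq = begin
    count (heavier? i)  ≡⟨ toℕ-fromℕ< (rank< i) ⟨
    toℕ (rank i)        ≡⟨ cong toℕ eq ⟩
    toℕ (rank j)        ≡⟨ toℕ-fromℕ< (rank< j) ⟩
    count (heavier? j)  ∎
    where open ≡-Reasoning

  -- the r+1 indices of rank ≤ r all weigh at least as much as the one of rank r
  rank-weight : ∀ i → suc (toℕ (rank i)) * s i ≤ ∑ s
  rank-weight i rewrite toℕ-fromℕ< (rank< i) = begin
    suc (count (heavier? i)) * s i   ≤⟨ *-monoˡ-≤ (s i) (heavier<atLeastAsHeavy i) ⟩
    count (atLeastAsHeavy? i) * s i  ≤⟨ count-weighted (atLeastAsHeavy? i) s (s i) key-≤ ⟩
    ∑ s                              ∎
    where open ≤-Reasoning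

  heavier-ranks-lower : ∀ {i j} → key i < key j → count (heavier? j) < count (heavier? i)
  heavier-ranks-lower {i} {j} i<j =
    count-strict (heavier? j) (heavier? i) (<-trans i<j) j i<j (<-irrefl refl)

  rank-injective : Injective _≡_ _≡_ rank
  rank-injective {i} {j} same-rank with <-cmp (key i) (key j)
  ... | tri< i<j _ _ = contradiction (heavier-ranks-lower i<j) (<-irrefl (sym (rank-counts same-rank)))
  ... | tri≈ _ eq _  = key-injective eq
  ... | tri> _ _ j<i = contradiction (heavier-ranks-lower j<i) (<-irrefl (rank-counts same-rank))

-- Routing from root paths

_↾_ : ∀ {ts} → PortAssignment (node ts) → (i : Fin (length ts)) → PortAssignment (lookup ts i)
(σ ↾ i) v = σ (down i v)

childPort : ∀ {ts} → PortAssignment (node ts) → Fin (length ts) → ℕ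
childPort σ c = suc (toℕ (σ root c))

portPath : (t : Tree) → PortAssignment t → Node t → List ℕ
portPath t         σ root       = []
portPath (node ts) σ (down i u) = childPort σ i ∷ portPath (lookup ts i) (σ ↾ i) u

nextPort : List ℕ → List ℕ → ℕ
nextPort []       []       = 0
nextPort []       (q ∷ _)  = q
nextPort (_ ∷ _)  []       = 0
nextPort (p ∷ ps) (q ∷ qs) = if does (p ≟ q) then nextPort ps qs else 0

routeAnswer-within : ∀ ts (σ : PortAssignment (node ts)) i u w →
  routeAnswer (node ts) σ (down i u) (down i w) ≡ routeAnswer (lookup ts i) (σ ↾ i) u w
routeAnswer-within ts σ i u w with i Fin.≟ i
... | no i≢i = contradiction refl i≢i
... | yes refl with nextHop (lookup ts i) u w
...   | nothing = refl
...   | just _  = refl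

routeAnswer-across : ∀ ts (σ : PortAssignment (node ts)) {i j} u w → i ≢ j →
  routeAnswer (node ts) σ (down i u) (down j w) ≡ 0
routeAnswer-across ts σ {i} {j} u w i≢j with i Fin.≟ j
... | yes i≡j = contradiction i≡j i≢j
... | no  _   = refl

nextPort-correct : ∀ t (σ : PortAssignment t) → (∀ u → Injective _≡_ _≡_ (σ u)) →
  ∀ u w → nextPort (portPath t σ u) (portPath t σ w) ≡ routeAnswer t σ u w

-- Both nodes strictly below the root: their first ports agree iff they lie
-- in the same child subtree, by injectivity of the ports at the root.
nextPort-correct-below : ∀ ts (σ : PortAssignment (node ts)) → (∀ u → Injective _≡_ _≡_ (σ u)) →
  ∀ {i j} u w → Dec (i ≡ j) →
  nextPort (portPath (node ts) σ (down i u)) (portPath (node ts) σ (down j w))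
    ≡ routeAnswer (node ts) σ (down i u) (down j w)

nextPort-correct t         σ inj root       root       = refl
nextPort-correct (node ts) σ inj root       (down i w) = refl
nextPort-correct (node ts) σ inj (down i u) root       = refl
nextPort-correct (node ts) σ inj (down i u) (down j w) =
  nextPort-correct-below ts σ inj u w (i Fin.≟ j)

nextPort-correct-below ts σ inj {i} u w (yes refl)
  rewrite dec-true (childPort σ i ≟ childPort σ i) refl =
    trans (nextPort-correct (lookup ts i) (σ ↾ i) (λ v → inj (down i v)) u w)
          (sym (routeAnswer-within ts σ i u w))
nextPort-correct-below ts σ inj {i} {j} u w (no i≢j)
  rewrite dec-false (childPort σ i ≟ childPort σ j) (i≢j ∘ inj root ∘ toℕ-injective ∘ suc-injective) =
    sym (routeAnswer-across ts σ u w i≢j)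

-- Heavy-first ports on trees

childSize : (t : Tree) → Fin (deg t) → ℕ
childSize (node ts) j = size (lookup ts j)

∑-childSize : ∀ ts → ∑ (childSize (node ts)) ≡ sizes ts
∑-childSize []       = refl
∑-childSize (t ∷ ts) = cong (size t +_) (∑-childSize ts)

heavyFirst : (t : Tree) → PortAssignment t
heavyFirst t u = HeavyFirst.rank (childSize (subtree t u))

heavyFirst-injective : ∀ t u → Injective _≡_ _≡_ (heavyFirst t u)
heavyFirst-injective t u = HeavyFirst.rank-injective (childSize (subtree t u))

-- The child behind port p has fewer than 1/p of its parent's nodes, so the
-- ports along a root path multiply to at most the size of the tree.
portPath-product : ∀ t u → product (portPath t (heavyFirst t) u) ≤ size t
portPath-product (node ts) root       = s≤s z≤n
portPath-product (node ts) (down i u) = begin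
  childPort σ i * product (portPath (lookup ts i) (heavyFirst (lookup ts i)) u)
    ≤⟨ *-monoʳ-≤ (childPort σ i) (portPath-product (lookup ts i) u) ⟩
  childPort σ i * size (lookup ts i)  ≤⟨ HeavyFirst.rank-weight (childSize (node ts)) i ⟩
  ∑ (childSize (node ts))             ≡⟨ ∑-childSize ts ⟩
  sizes ts                            <⟨ n<1+n (sizes ts) ⟩
  size (node ts)                      ∎
  where
    open ≤-Reasoning
    σ : PortAssignment (node ts)
    σ = heavyFirst (node ts)

portPath-nonZero : ∀ t (σ : PortAssignment t) u → All NonZero (portPath t σ u)
portPath-nonZero t         σ root       = []
portPath-nonZero (node ts) σ (down i u) = _ ∷ portPath-nonZero (lookup ts i) (σ ↾ i) u

portPath-logSum : ∀ t u → logSum (portPath t (heavyFirst t) u) ≤ ⌈log₂ size t ⌉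
portPath-logSum t u = 2^-cancel-≤ (begin
  2 ^ logSum ps       ≤⟨ 2^logSum≤product ps (portPath-nonZero t (heavyFirst t) u) ⟩
  product ps          ≤⟨ portPath-product t u ⟩
  size t              ≤⟨ n≤2^⌈log₂n⌉ (size t) ⟩
  2 ^ ⌈log₂ size t ⌉  ∎)
  where
    open ≤-Reasoning
    ps : List ℕ
    ps = portPath t (heavyFirst t) u

depth-child : ∀ ts i → suc (depth (lookup ts i)) ≤ depths ts
depth-child (t ∷ ts) Fin.zero    = m≤m⊔n (suc (depth t)) (depths ts)
depth-child (t ∷ ts) (Fin.suc i) = ≤-trans (depth-child ts i) (m≤n⊔m (suc (depth t)) (depths ts))

portPath-length : ∀ t (σ : PortAssignment t) u → length (portPath t σ u) ≤ depth t
portPath-length t         σ root       = z≤n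
portPath-length (node ts) σ (down i u) =
  ≤-trans (s≤s (portPath-length (lookup ts i) (σ ↾ i) u)) (depth-child ts i)

-- The labeling scheme

-- Header width for L = ⌈log₂ n⌉: 1 + ⌈log₂ L⌉ bits hold every number up to L.
headerWidth : ℕ → ℕ
headerWidth L = suc ⌈log₂ L ⌉

L<2^headerWidth : ∀ L → L < 2 ^ headerWidth L
L<2^headerWidth L = begin-strict
  L                  ≤⟨ n≤2^⌈log₂n⌉ L ⟩
  2 ^ ⌈log₂ L ⌉      <⟨ ^-monoʳ-< 2 (s≤s (s≤s z≤n)) (n<1+n ⌈log₂ L ⌉) ⟩
  2 ^ headerWidth L  ∎
  where open ≤-Reasoning

label : (t : Tree) → Node t → List Bool
label t u = encodeList (headerWidth ⌈log₂ size t ⌉) (portPath t (heavyFirst t) u)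

route : ℕ → List Bool → List Bool → ℕ
route L a b = nextPort (decodeList (headerWidth L) a) (decodeList (headerWidth L) b)

-- Every header fits, since each ⌊log₂ p⌋ is at most the path's logSum ≤ L.
decode-label : ∀ t u → decodeList (headerWidth ⌈log₂ size t ⌉) (label t u) ≡ portPath t (heavyFirst t) u
decode-label t u = decodeList-encodeList ⌈log₂ L ⌉ ps
  (All.map (λ log≤ → ≤-<-trans (≤-trans log≤ (portPath-logSum t u)) (L<2^headerWidth L))
           (log≤logSum ps))
  where
    L : ℕ
    L = ⌈log₂ size t ⌉
    ps : List ℕ
    ps = portPath t (heavyFirst t) u

route-label : ∀ t u w → route ⌈log₂ size t ⌉ (label t u) (label t w) ≡ routeAnswer t (heavyFirst t) u w
route-label t u w = trans (cong₂ nextPort (decode-label t u) (decode-label t w))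
                          (nextPort-correct t (heavyFirst t) (heavyFirst-injective t) u w)

-- Each of the at most d code words costs 2 + log log n bits besides its
-- share of the log n bits accounted for by portPath-logSum.
label-length : ∀ {d} t → depth t ≤ d → ∀ u →
  length (label t u) ≤ ⌈log₂ size t ⌉ + (2 * d) * ⌈log₂ ⌈log₂ size t ⌉ ⌉ + 2 * d
label-length {d} t depth≤d u = begin
  length (label t u)                ≡⟨ length-encodeList (headerWidth L) ps ⟩
  length ps * (2 + LL) + logSum ps  ≤⟨ +-mono-≤ (*-monoˡ-≤ (2 + LL) path≤d) (portPath-logSum t u) ⟩
  d * (2 + LL) + L                  ≡⟨ solve 3 (λ d LL L → d :* (con 2 :+ LL) :+ L := L :+ d :* LL :+ con 2 :* d)
                                             refl d LL L ⟩
  L + d * LL + 2 * d                ≤⟨ +-monoˡ-≤ (2 * d) (+-monoʳ-≤ L (*-monoˡ-≤ LL (m≤n*m d 2))) ⟩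
  L + (2 * d) * LL + 2 * d          ∎
  where
    open ≤-Reasoning
    open +-*-Solver
    L : ℕ
    L = ⌈log₂ size t ⌉
    LL : ℕ
    LL = ⌈log₂ L ⌉
    ps : List ℕ
    ps = portPath t (heavyFirst t) u
    path≤d : length ps ≤ d
    path≤d = ≤-trans (portPath-length t (heavyFirst t) u) depth≤d

mainTheorem7 : (d : ℕ) →
    ∃[ c ] Σ (ℕ → List Bool → List Bool → ℕ) λ decode →
      (t : Tree) → depth t ≤ d →
        Σ (Node t → List Bool) λ ℓ →
        Σ (PortAssignment t) λ σ →
          ((u : Node t) → Injective _≡_ _≡_ (σ u))
          × ((u : Node t) → length (ℓ u) ≤ ⌈log₂ size t ⌉ + c * ⌈log₂ ⌈log₂ size t ⌉ ⌉ + c)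
          × ((u w : Node t) → u ≢ w → decode ⌈log₂ size t ⌉ (ℓ u) (ℓ w) ≡ routeAnswer t σ u w)
mainTheorem7 d = 2 * d , route , λ t depth≤d →
  label t , heavyFirst t , heavyFirst-injective t , label-length t depth≤d ,
  λ u w _ → route-label t u w
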